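{- Let $A\subset\mathbb{N}_0$ be a finite 3-free set, let $S(A)$ be the Stanley sequence generated by $A$, and let $S(A,x)=|\{s\in S(A): s\le x\}|$ be its counting function. Then for every $\epsilon>0$ there exists $x_0(\epsilon,A)$ such that for all $x\ge x_0(\epsilon,A)$, \[ S(A,x)\ge (\sqrt{2}-\epsilon)\sqrt{x}. \]
   Context: $\mathbb{N}_0$ denotes the set of nonnegative integers. A subset of $\mathbb{N}_0$ is 3-free if it contains no three-term arithmetic progression. Given a finite 3-free set $A=\{a_1,\dots,a_t\}\subset\mathbb{N}_0$ with $a_1<\dots<a_t$, the Stanley sequence generated by $A$ is the infinite sequence $S(A)=\{a_1,a_2,a_3,\dots\}$ defined recursively: for $k\ge t$, once $a_1<\dots<a_k$ are defined, $a_{k+1}$ is the smallest integer $a>a_k$ such that $\{a_1,\dots,a_k\}\cup\{a\}$ is 3-free. -}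

module Defs where

open import Data.Nat using (ℕ; zero; suc; _+_; _⊔_; _<_; _≡ᵇ_; _≤ᵇ_)
open import Data.Bool using (Bool; true; false; not; if_then_else_)
open import Data.List using (List; []; _∷_; _++_; [_]; foldr; length)
open import Data.Bool.ListAction using (any)
open import Data.List.Membership.Propositional using (_∈_)
open import Relation.Binary.PropositionalEquality using (_≢_)

ThreeFree : List ℕ → Set
ThreeFree A = ∀ {a b c} → a ∈ A → b ∈ A → c ∈ A → a < b → b < c → a + c ≢ b + b

maxL : List ℕ → ℕ
maxL = foldr _⊔_ 0

memberᵇ : ℕ → List ℕ → Bool
memberᵇ n = any (n ≡ᵇ_)

-- does adding n (larger than every element of L) create a 3-term AP a, b, n
-- with a, b ∈ L ?  (a + n = 2b with a, b < n forces a < b < n)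
closesAP : List ℕ → ℕ → Bool
closesAP L n = any (λ a → any (λ b → (a + n) ≡ᵇ (b + b)) L) L

inStanley : List ℕ → List ℕ → ℕ → Bool
inStanley A L n = if n ≤ᵇ maxL A then memberᵇ n A else not (closesAP L n)

-- stanleyBelow A n = the elements of S(A) that are < n, in increasing order
-- (greedy recursion: beyond max A, n is taken iff it closes no 3-term AP
--  with earlier terms)
stanleyBelow : List ℕ → ℕ → List ℕ
stanleyBelow A zero = []
stanleyBelow A (suc n) =
  stanleyBelow A n ++ (if inStanley A (stanleyBelow A n) n then [ n ] else [])

stanleyCount : List ℕ → ℕ → ℕ
stanleyCount A x = length (stanleyBelow A (suc x))

module Submission where

-- Beyond max A an integer n is rejected from S(A) only because it closes a
-- progression a < b < n with a, b ∈ S(A), and then n = 2b − a is determined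
-- by the pair {a, b}.  So among 0, …, x the integers not in S(A) number at
-- most max A + 1 plus the number of pairs of elements of S(A) ≤ x, and with
-- c = S(A, x) this gives  2x ≤ 2 max A + c + c²,  whence c² ≳ 2x.
--
-- The injectivity of n ↦ {a, b} is made constructive by a potential: the
-- length of the list of terms below n plus the number of pairs {a, b} in it
-- whose progression a, b, 2b − a has already ended below n.  Every step
-- n → n + 1 beyond max A raises the potential by at least one.
--
-- The argument never uses that A is nonempty
-- or 3-free.

open import Defs
open import Data.Nat using (ℕ; _+_; _*_; _≤_; _<_)
open import Data.List using (List; [])
open import Data.Product using (∃)
open import Relation.Binary.PropositionalEquality using (_≢_)

open import Data.Nat using (suc; z≤n; s≤s; _<ᵇ_; _≤ᵇ_)
open import Data.Nat.Properties
open import Data.Nat.Tactic.RingSolver using (solve-∀)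
open import Data.Bool using (Bool; true; false; T; _∧_; _∨_; if_then_else_)
open import Data.Bool.Properties using (T-∧; T-∨; ∨-comm)
open import Data.Unit using (tt)
open import Data.List using (_∷_; _++_; [_]; length)
open import Data.List.Properties using (length-++; ++-identityʳ)
open import Data.List.Membership.Propositional using (_∈_; find)
open import Data.List.Membership.Propositional.Properties using (∈-++⁻)
open import Data.List.Relation.Unary.Any using (here; there)
open import Data.List.Relation.Unary.Any.Properties using (any⁻)
open import Data.Product using (_×_; _,_; proj₁; proj₂)
import Data.Sum as Sum
open import Data.Sum using (_⊎_; inj₁; inj₂)
open import Data.Empty using (⊥-elim)
open import Function using (_∘_)
open import Function.Bundles using (Equivalence)
open import Relation.Nullary using (¬_; contradiction; yes; no)
open import Relation.Binary.PropositionalEquality using (_≡_; refl; sym; trans; cong; subst)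

ind : Bool → ℕ
ind b = if b then 1 else 0

count : (ℕ → Bool) → List ℕ → ℕ
count f [] = 0
count f (x ∷ xs) = ind (f x) + count f xs

_⇒ᵇ_ : (ℕ → Bool) → (ℕ → Bool) → Set
f ⇒ᵇ g = ∀ y → T (f y) → T (g y)

ind≤1 : ∀ b → ind b ≤ 1
ind≤1 true = ≤-refl
ind≤1 false = z≤n

ind-mono : ∀ {b c} → (T b → T c) → ind b ≤ ind c
ind-mono {false} _ = z≤n
ind-mono {true} {true} _ = ≤-refl
ind-mono {true} {false} b⇒c = ⊥-elim (b⇒c tt)

ind-strict : ∀ {b c} → ¬ T b → T c → ind b < ind c
ind-strict {true} ¬b _ = ⊥-elim (¬b tt)
ind-strict {false} {true} _ _ = s≤s z≤n

count≤length : ∀ f xs → count f xs ≤ length xs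
count≤length f [] = z≤n
count≤length f (x ∷ xs) = +-mono-≤ (ind≤1 (f x)) (count≤length f xs)

count-mono : ∀ {f g} → f ⇒ᵇ g → ∀ xs → count f xs ≤ count g xs
count-mono f⇒g [] = z≤n
count-mono f⇒g (x ∷ xs) = +-mono-≤ (ind-mono (f⇒g x)) (count-mono f⇒g xs)

count-strict : ∀ {f g} → f ⇒ᵇ g → ∀ {y xs} → y ∈ xs → ¬ T (f y) → T (g y) →
  count f xs < count g xs
count-strict f⇒g {xs = _ ∷ xs} (here refl) ¬fy gy =
  +-mono-<-≤ (ind-strict ¬fy gy) (count-mono f⇒g xs)
count-strict f⇒g {xs = x ∷ _} (there y∈xs) ¬fy gy =
  +-mono-≤-< (ind-mono (f⇒g x)) (count-strict f⇒g y∈xs ¬fy gy)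

count-++ : ∀ f xs ys → count f xs ≤ count f (xs ++ ys)
count-++ f [] ys = z≤n
count-++ f (x ∷ xs) ys = +-monoʳ-≤ (ind (f x)) (count-++ f xs ys)

BRel : Set
BRel = ℕ → ℕ → Bool

_⊆ᵇ_ : BRel → BRel → Set
R ⊆ᵇ R′ = ∀ a → R a ⇒ᵇ R′ a

Symmetricᵇ : BRel → Set
Symmetricᵇ R = ∀ a b → R a b ≡ R b a

pairs : BRel → List ℕ → ℕ
pairs R [] = 0
pairs R (a ∷ L) = count (R a) L + pairs R L

pairs-bound : ∀ R L → 2 * pairs R L + length L ≤ length L * length L
pairs-bound R [] = z≤n
pairs-bound R (a ∷ L) = begin
    2 * (k + pairs R L) + suc c      ≡⟨ regroup k (pairs R L) c ⟩
    2 * k + suc (2 * pairs R L + c)  ≤⟨ +-monoˡ-≤ _ (*-monoʳ-≤ 2 (count≤length (R a) L)) ⟩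
    2 * c + suc (2 * pairs R L + c)  ≤⟨ +-monoʳ-≤ (2 * c) (s≤s (pairs-bound R L)) ⟩
    2 * c + suc (c * c)              ≡⟨ square-suc c ⟩
    suc c * suc c                    ∎
  where
  open ≤-Reasoning
  k = count (R a) L
  c = length L
  regroup : ∀ k p c → 2 * (k + p) + suc c ≡ 2 * k + suc (2 * p + c)
  regroup = solve-∀
  square-suc : ∀ c → 2 * c + suc (c * c) ≡ suc c * suc c
  square-suc = solve-∀

pairs-mono : ∀ {R R′} → R ⊆ᵇ R′ → ∀ L → pairs R L ≤ pairs R′ L
pairs-mono R⊆R′ [] = z≤n
pairs-mono R⊆R′ (a ∷ L) = +-mono-≤ (count-mono (R⊆R′ a) L) (pairs-mono R⊆R′ L)

pairs-++ : ∀ R L M → pairs R L ≤ pairs R (L ++ M)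
pairs-++ R [] M = z≤n
pairs-++ R (a ∷ L) M = +-mono-≤ (count-++ (R a) L M) (pairs-++ R L M)

pairs-strict : ∀ {R R′} → R ⊆ᵇ R′ → Symmetricᵇ R → Symmetricᵇ R′ →
  ∀ {a b L} → a ∈ L → b ∈ L → a ≢ b → ¬ T (R a b) → T (R′ a b) →
  pairs R L < pairs R′ L
pairs-strict ⊆ sym-R sym-R′ (here refl) (here refl) a≢b ¬Rab R′ab = contradiction refl a≢b
pairs-strict ⊆ sym-R sym-R′ {L = _ ∷ L} (here refl) (there b∈L) a≢b ¬Rab R′ab =
  +-mono-<-≤ (count-strict (⊆ _) b∈L ¬Rab R′ab) (pairs-mono ⊆ L)
pairs-strict ⊆ sym-R sym-R′ {a} {b} {_ ∷ L} (there a∈L) (here refl) a≢b ¬Rab R′ab =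
  +-mono-<-≤ (count-strict (⊆ b) a∈L (¬Rab ∘ subst T (sym-R b a)) (subst T (sym-R′ a b) R′ab))
    (pairs-mono ⊆ L)
pairs-strict ⊆ sym-R sym-R′ {L = x ∷ L} (there a∈L) (there b∈L) a≢b ¬Rab R′ab =
  +-mono-≤-< (count-mono (⊆ x) L) (pairs-strict ⊆ sym-R sym-R′ a∈L b∈L a≢b ¬Rab R′ab)

-- spans n a b: a < b, and the third term 2b − a of the progression a, b, …
-- is smaller than n (stated without subtraction as 2b < a + n).
spans : ℕ → BRel
spans n a b = (a <ᵇ b) ∧ (b + b <ᵇ a + n)

near : ℕ → BRel
near n a b = spans n a b ∨ spans n b a

spans⇒ : ∀ n a b → T (spans n a b) → a < b × b + b < a + n
spans⇒ n a b h with Equivalence.to (T-∧ {a <ᵇ b}) h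
... | lt₁ , lt₂ = <ᵇ⇒< a b lt₁ , <ᵇ⇒< (b + b) (a + n) lt₂

spans⇐ : ∀ n a b → a < b → b + b < a + n → T (spans n a b)
spans⇐ n a b lt₁ lt₂ = Equivalence.from T-∧ (<⇒<ᵇ lt₁ , <⇒<ᵇ lt₂)

near-sym : ∀ n → Symmetricᵇ (near n)
near-sym n a b = ∨-comm (spans n a b) (spans n b a)

near-mono : ∀ n → near n ⊆ᵇ near (suc n)
near-mono n a b h =
  Equivalence.from T-∨ (Sum.map (spans-mono a b) (spans-mono b a) (Equivalence.to T-∨ h))
  where
  spans-mono : ∀ a b → T (spans n a b) → T (spans (suc n) a b)
  spans-mono a b h with spans⇒ n a b h
  ... | a<b , lt = spans⇐ (suc n) a b a<b (<-≤-trans lt (+-monoʳ-≤ a (n≤1+n n)))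

near-closing : ∀ n a b → a < b → a + n ≡ b + b → ¬ T (near n a b) × T (near (suc n) a b)
near-closing n a b a<b closes = not-yet , now
  where
  not-yet : ¬ T (near n a b)
  not-yet h with Equivalence.to T-∨ h
  ... | inj₁ ab = <-irrefl (sym closes) (proj₂ (spans⇒ n a b ab))
  ... | inj₂ ba = <-asym a<b (proj₁ (spans⇒ n b a ba))
  now : T (near (suc n) a b)
  now = Equivalence.from T-∨
    (inj₁ (spans⇐ (suc n) a b a<b (≤-reflexive (trans (cong suc (sym closes)) (sym (+-suc a n))))))

stanleyBelow-< : ∀ A n {x} → x ∈ stanleyBelow A n → x < n
stanleyBelow-< A (suc n) x∈
  with inStanley A (stanleyBelow A n) n | ∈-++⁻ (stanleyBelow A n) x∈
... | _    | inj₁ x∈old = m≤n⇒m≤1+n (stanleyBelow-< A n x∈old)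
... | true | inj₂ (here refl) = ≤-refl

closesAP-witness : ∀ {L n} → (∀ {x} → x ∈ L → x < n) → T (closesAP L n) →
  ∃ λ a → ∃ λ b → a ∈ L × b ∈ L × a < b × a + n ≡ b + b
closesAP-witness {L} {n} below closes
  with find (any⁻ _ L closes)
... | a , a∈L , closes-a with find (any⁻ _ L closes-a)
...   | b , b∈L , eqᵇ = a , b , a∈L , b∈L , a<b , eq
  where
  eq : a + n ≡ b + b
  eq = ≡ᵇ⇒≡ (a + n) (b + b) eqᵇ
  a<b : a < b
  a<b with a <? b
  ... | yes a<b = a<b
  ... | no a≮b = ⊥-elim (<-irrefl (sym eq) (+-mono-≤-< (≮⇒≥ a≮b) (below b∈L)))

potential : ℕ → List ℕ → ℕ
potential n L = length L + pairs (near n) L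

-- Accepting n raises the potential: the list grows by one.
potential-accept : ∀ n L → potential n L < potential (suc n) (L ++ [ n ])
potential-accept n L = begin-strict
    length L + pairs (near n) L              <⟨ n<1+n _ ⟩
    suc (length L) + pairs (near n) L        ≡⟨ cong (_+ pairs (near n) L) (+-comm 1 (length L)) ⟩
    (length L + 1) + pairs (near n) L        ≡⟨ cong (_+ pairs (near n) L) (sym (length-++ L)) ⟩
    length (L ++ [ n ]) + pairs (near n) L   ≤⟨ +-monoʳ-≤ (length (L ++ [ n ])) more-pairs ⟩
    potential (suc n) (L ++ [ n ])           ∎
  where
  open ≤-Reasoning
  more-pairs : pairs (near n) L ≤ pairs (near (suc n)) (L ++ [ n ])
  more-pairs = ≤-trans (pairs-mono (near-mono n) L) (pairs-++ (near (suc n)) L [ n ])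

-- Rejecting n = 2b − a raises the potential: the pair {a, b} becomes near.
potential-reject : ∀ n {L a b} → a ∈ L → b ∈ L → a < b → a + n ≡ b + b →
  potential n L < potential (suc n) L
potential-reject n {L} {a} {b} a∈L b∈L a<b closes with near-closing n a b a<b closes
... | not-yet , now = +-monoʳ-< (length L)
  (pairs-strict (near-mono n) (near-sym n) (near-sym (suc n)) a∈L b∈L (<⇒≢ a<b) not-yet now)

stanley-step : ∀ A n → n ≤ maxL A ⊎
  potential n (stanleyBelow A n) < potential (suc n) (stanleyBelow A (suc n))
stanley-step A n with n ≤ᵇ maxL A in initial
... | true = inj₁ (≤ᵇ⇒≤ n (maxL A) (subst T (sym initial) tt))
... | false with closesAP (stanleyBelow A n) n in closes
...   | false = inj₂ (potential-accept n (stanleyBelow A n))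
...   | true with closesAP-witness (stanleyBelow-< A n) (subst T (sym closes) tt)
...     | a , b , a∈L , b∈L , a<b , eq rewrite ++-identityʳ (stanleyBelow A n) =
  inj₂ (potential-reject n a∈L b∈L a<b eq)

-- Invariant: n ≤ max A + 1 + potential, i.e. each m < n is at most max A,
-- a term of S(A), or the third term of a near pair.
stanley-invariant : ∀ A n → n ≤ suc (maxL A) + potential n (stanleyBelow A n)
stanley-invariant A 0 = z≤n
stanley-invariant A (suc n) with stanley-step A n
... | inj₁ n≤max = ≤-trans (s≤s n≤max) (m≤m+n (suc (maxL A)) _)
... | inj₂ grows = begin
    suc n                                                  ≤⟨ s≤s (stanley-invariant A n) ⟩
    suc (suc (maxL A) + potential n (stanleyBelow A n))    ≡⟨ sym (+-suc (suc (maxL A)) _) ⟩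
    suc (maxL A) + suc (potential n (stanleyBelow A n))    ≤⟨ +-monoʳ-≤ (suc (maxL A)) grows ⟩
    suc (maxL A) + potential (suc n) (stanleyBelow A (suc n)) ∎
  where open ≤-Reasoning

stanley-quadratic : ∀ A x →
  2 * x ≤ 2 * maxL A + stanleyCount A x + stanleyCount A x * stanleyCount A x
stanley-quadratic A x = +-cancelˡ-≤ 2 _ _ (begin
    2 + 2 * x                           ≡⟨ double-suc x ⟩
    2 * suc x                           ≤⟨ *-monoʳ-≤ 2 (stanley-invariant A (suc x)) ⟩
    2 * (suc m + (c + P))               ≡⟨ regroup m c P ⟩
    2 + (2 * m + c + (2 * P + c))       ≤⟨ +-monoʳ-≤ (2 + (2 * m + c)) (pairs-bound (near (suc x)) L) ⟩
    2 + (2 * m + c + c * c)             ∎)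
  where
  open ≤-Reasoning
  L = stanleyBelow A (suc x)
  m = maxL A
  c = length L
  P = pairs (near (suc x)) L
  double-suc : ∀ x → 2 + 2 * x ≡ 2 * suc x
  double-suc = solve-∀
  regroup : ∀ m c P → 2 * (suc m + (c + P)) ≡ 2 + (2 * m + c + (2 * P + c))
  regroup = solve-∀

-- When c² < 2x and x ≥ 8Q², the linear term is small: 2Qc ≤ x.
-- (Otherwise x² < 4Q²c² < 8Q²x.)
linear-term-small : ∀ Q c x → 8 * Q * Q ≤ x → c * c < 2 * x → 2 * Q * c ≤ x
linear-term-small Q c x x-large c²<2x with 2 * Q * c ≤? x
... | yes small = small
... | no ¬small = ⊥-elim (<⇒≱ (*-cancelʳ-< x x (8 * Q * Q) x²<8Q²x) x-large)
  where
  open ≤-Reasoning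
  x<2Qc = ≰⇒> ¬small
  x²<8Q²x : x * x < 8 * Q * Q * x
  x²<8Q²x = begin-strict
    x * x                    <⟨ *-mono-< x<2Qc x<2Qc ⟩
    2 * Q * c * (2 * Q * c)  ≡⟨ square Q c ⟩
    4 * (Q * Q) * (c * c)    ≤⟨ *-monoʳ-≤ (4 * (Q * Q)) (<⇒≤ c²<2x) ⟩
    4 * (Q * Q) * (2 * x)    ≡⟨ regroup Q x ⟩
    8 * Q * Q * x            ∎
    where
    square : ∀ Q c → 2 * Q * c * (2 * Q * c) ≡ 4 * (Q * Q) * (c * c)
    square = solve-∀
    regroup : ∀ Q x → 4 * (Q * Q) * (2 * x) ≡ 8 * Q * Q * x
    regroup = solve-∀

quadratic-lower-bound : ∀ P Q M c x → P < 2 * Q → 8 * Q * Q + 2 * Q * M ≤ x →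
  2 * x ≤ M + c + c * c → P * x ≤ Q * (c * c)
quadratic-lower-bound P Q M c x P<2Q x-large bound with 2 * x ≤? c * c
... | yes 2x≤c² = begin
    P * x        ≤⟨ *-monoˡ-≤ x (<⇒≤ P<2Q) ⟩
    2 * Q * x    ≡⟨ regroup Q x ⟩
    Q * (2 * x)  ≤⟨ *-monoʳ-≤ Q 2x≤c² ⟩
    Q * (c * c)  ∎
  where
  open ≤-Reasoning
  regroup : ∀ Q x → 2 * Q * x ≡ Q * (2 * x)
  regroup = solve-∀
... | no 2x≰c² = *-cancelˡ-≤ 2 (+-cancelʳ-≤ (2 * x) _ _ (begin
    2 * (P * x) + 2 * x                 ≡⟨ expand P x ⟩
    suc P * (2 * x)                     ≤⟨ *-monoˡ-≤ (2 * x) P<2Q ⟩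
    2 * Q * (2 * x)                     ≤⟨ *-monoʳ-≤ (2 * Q) bound ⟩
    2 * Q * (M + c + c * c)             ≡⟨ distribute Q M c ⟩
    2 * Q * M + 2 * Q * c + 2 * Q * (c * c)  ≤⟨ +-monoˡ-≤ (2 * Q * (c * c)) (+-mono-≤ M-term c-term) ⟩
    x + x + 2 * Q * (c * c)             ≡⟨ collect x Q (c * c) ⟩
    2 * (Q * (c * c)) + 2 * x           ∎))
  where
  open ≤-Reasoning
  M-term : 2 * Q * M ≤ x
  M-term = ≤-trans (m≤n+m _ _) x-large
  c-term : 2 * Q * c ≤ x
  c-term = linear-term-small Q c x (≤-trans (m≤m+n _ _) x-large) (≰⇒> 2x≰c²)
  expand : ∀ P x → 2 * (P * x) + 2 * x ≡ suc P * (2 * x)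
  expand = solve-∀
  distribute : ∀ Q M c → 2 * Q * (M + c + c * c) ≡ 2 * Q * M + 2 * Q * c + 2 * Q * (c * c)
  distribute = solve-∀
  collect : ∀ x Q C → x + x + 2 * Q * C ≡ 2 * (Q * C) + 2 * x
  collect = solve-∀

-- Main theorem: for every rational p/q < √2, eventually (p/q)² x ≤ S(A, x)².
theorem1 : (A : List ℕ) → A ≢ [] → ThreeFree A →
    (p q : ℕ) → 0 < q → p * p < 2 * (q * q) →
    ∃ λ x₀ → ∀ x → x₀ ≤ x →
      p * p * x ≤ q * q * (stanleyCount A x * stanleyCount A x)
theorem1 A _ _ p q _ p²<2q² = x₀ , eventually
  where
  Q = q * q
  M = 2 * maxL A
  x₀ = 8 * Q * Q + 2 * Q * M
  eventually : ∀ x → x₀ ≤ x → p * p * x ≤ Q * (stanleyCount A x * stanleyCount A x)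
  eventually x x₀≤x =
    quadratic-lower-bound (p * p) Q M (stanleyCount A x) x p²<2q² x₀≤x (stanley-quadratic A x)
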